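{- Let $G$ be a finite simple undirected graph, let $r \ge 2$, and let $S$ be an $r$-partial game of Trail Trap on $G$. Let $E_S$ be the set of edges of $G$ not used in $S$, let $G_S = (V(G), E_S)$, and let $v_1$ and $v_2$ be the heads (ending vertices) of moves $r-1$ and $r$ of $S$, respectively. If there exists an involutive automorphism $\phi$ of $G_S$ with no fixed edges and $\phi(v_1) = v_2$, then, in the game continuing from $S$, Player 1 has a winning strategy if $r$ is odd and Player 2 has a winning strategy if $r$ is even.
   Context: Trail Trap on a finite simple undirected graph $G$: Player 1 (P1) chooses a vertex, places a token on it and moves it along an incident edge $e$ to the other endpoint. Player 2 (P2) then places their own token on any vertex and moves it along an incident edge $f \neq e$. Thereafter the players alternate, starting with P1, each moving their own token from its current vertex along an unused edge (an edge not previously traversed, in either direction, by either player) to the adjacent vertex; vertices may be revisited and the two tokens may share a vertex. The first player unable to move loses. A move is an ordered pair $u \to v$ with $uv \in E(G)$; $u$ is its tail and $v$ its head. Turns are numbered so that P1 makes moves $1,3,5,\dots$ and P2 makes moves $2,4,6,\dots$. For $r \le |E(G)|$, an $r$-partial game is an ordered $r$-tuple of moves in which each edge of $G$ occurs at most once and, for every $i \in \{1,\dots,r-2\}$, the head of move $i$ equals the tail of move $i+2$; the game continues from $S$ with the player to make move $r+1$, each player continuing from the head of their last move. An automorphism $\phi$ is involutive if $\phi(\phi(v))=v$ for all $v$; an edge $ab$ is a fixed edge of $\phi$ if either $\phi(a)=b,\phi(b)=a$ or $\phi(a)=a,\phi(b)=b$. -}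

module Defs where

open import Data.Nat using (ℕ; zero; suc; _+_; _*_; _≤_; _<_; s≤s; z≤n)
open import Data.Fin using (Fin; toℕ; fromℕ; inject₁)
open import Data.Product using (Σ; ∃; _×_; _,_; proj₁; proj₂)
open import Data.Sum using (_⊎_)
open import Data.List using (List; []; _∷_; tabulate)
open import Data.List.Relation.Unary.Any using (Any)
open import Data.Empty using (⊥)
open import Relation.Nullary using (¬_)
open import Relation.Binary.PropositionalEquality using (_≡_; _≢_)
open import Function.Definitions using (Bijective)

record Graph (n : ℕ) : Set₁ where
  field
    Adj   : Fin n → Fin n → Set
    sym   : ∀ {u v} → Adj u v → Adj v u
    irrefl : ∀ {u} → ¬ Adj u u

Move : ℕ → Set
Move n = Fin n × Fin n

tail : ∀ {n} → Move n → Fin n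
tail = proj₁

head : ∀ {n} → Move n → Fin n
head = proj₂

SameEdge : ∀ {n} → Move n → Move n → Set
SameEdge (a , b) (c , d) = (a ≡ c × b ≡ d) ⊎ (a ≡ d × b ≡ c)

Used : ∀ {n} → List (Move n) → Fin n → Fin n → Set
Used ms u v = Any (SameEdge (u , v)) ms

Unused : ∀ {n} → List (Move n) → Fin n → Fin n → Set
Unused ms u v = ¬ Used ms u v

-- An r-partial game: moves indexed 0..r-1 (index k is move k+1 of the paper).
record PartialGame {n} (G : Graph n) (r : ℕ) : Set where
  field
    move     : Fin r → Move n
    isEdge   : ∀ i → Graph.Adj G (tail (move i)) (head (move i))
    distinct : ∀ i j → i ≢ j → ¬ SameEdge (move i) (move j)
    chain    : ∀ (i j : Fin r) → toℕ j ≡ 2 + toℕ i → head (move i) ≡ tail (move j)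

movesList : ∀ {A : Set} {r : ℕ} → (Fin r → A) → List A
movesList = tabulate

lastIdx : ∀ {r} → 2 ≤ r → Fin r
lastIdx {suc k} (s≤s _) = fromℕ k

secondLastIdx : ∀ {r} → 2 ≤ r → Fin r
secondLastIdx {suc (suc k)} (s≤s (s≤s _)) = inject₁ (fromℕ k)

AdjS : ∀ {n} (G : Graph n) (ms : List (Move n)) → Fin n → Fin n → Set
AdjS G ms u v = Graph.Adj G u v × Unused ms u v

IsAutomorphism : ∀ {n} → (Fin n → Fin n → Set) → (Fin n → Fin n) → Set
IsAutomorphism E φ = Bijective _≡_ _≡_ φ
  × (∀ u v → (E u v → E (φ u) (φ v)) × (E (φ u) (φ v) → E u v))

Involutive : ∀ {n} → (Fin n → Fin n) → Set
Involutive φ = ∀ v → φ (φ v) ≡ v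

FixedEdge : ∀ {n} → (Fin n → Fin n) → Fin n → Fin n → Set
FixedEdge φ a b = (φ a ≡ b × φ b ≡ a) ⊎ (φ a ≡ a × φ b ≡ b)

NoFixedEdges : ∀ {n} → (Fin n → Fin n → Set) → (Fin n → Fin n) → Set
NoFixedEdges E φ = ∀ a b → E a b → ¬ FixedEdge φ a b

-- State: list of used moves, vertex a of the player to
-- move, vertex b of the other player.
-- Loses used a b : the player to move has no way to avoid losing, i.e. the
--                  other player has a winning strategy.
module Play {n} (G : Graph n) where
  open Graph G
  mutual
    data Wins (used : List (Move n)) (a b : Fin n) : Set where
      wins : (a' : Fin n) → Adj a a' → Unused used a a'
           → Loses ((a , a') ∷ used) b a' → Wins used a b

    data Loses (used : List (Move n)) (a b : Fin n) : Set where
      loses : ((a' : Fin n) → Adj a a' → Unused used a a'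
              → Wins ((a , a') ∷ used) b a') → Loses used a b

data Player : Set where
  P1 P2 : Player

-- player to make move k+1 after k moves
toMove : ℕ → Player
toMove zero = P1
toMove (suc zero) = P2
toMove (suc (suc k)) = toMove k

Even Odd : ℕ → Set
Even r = ∃ λ k → r ≡ 2 * k
Odd r = ∃ λ k → r ≡ 1 + 2 * k

forPlayer : Player → Player → Set → Set → Set
forPlayer P1 P1 w l = w
forPlayer P2 P2 w l = w
forPlayer P1 P2 w l = l
forPlayer P2 P1 w l = l

-- Player p has a winning strategy in the game continuing from S.
-- The player to make move r+1 made move r-1, so sits at its head; the
-- other player sits at the head of move r.
HasWinningStrategy : ∀ {n} (G : Graph n) {r} → 2 ≤ r → PartialGame G r → Player → Set
HasWinningStrategy G {r} h S p =
  forPlayer (toMove r) p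
    (Play.Wins G usedS v₁ v₂) (Play.Loses G usedS v₁ v₂)
  where
    usedS = movesList (PartialGame.move S)
    v₁ = head (PartialGame.move S (secondLastIdx h))
    v₂ = head (PartialGame.move S (lastIdx h))

usedOf : ∀ {n} {G : Graph n} {r} → PartialGame G r → List (Move n)
usedOf S = movesList (PartialGame.move S)

-- Mirror strategy: the player who made move r answers each move a → a′ of
-- the opponent, made while the tokens sit on a and φ a, by φ a → φ a′. The
-- reply is an edge of G_S because φ is an automorphism of G_S; it is not the
-- edge a a′ because φ fixes no edge. So the mirroring player can always
-- move, and as each round uses up two edges, the opponent eventually cannot.
module Submission where

open import Defs
open import Data.Nat using (ℕ; _≤_)
open import Data.Fin using (Fin)
open import Data.Product using (Σ; _×_)
open import Relation.Binary.PropositionalEquality using (_≡_)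

open import Data.Nat using (zero; suc; _+_; _<_; _*_; z≤n; s≤s)
open import Data.Nat.Properties using (m≤n⇒m≤1+n; <-trans; +-suc)
open import Data.Nat.Induction using (<-wellFounded)
open import Data.Fin using (_≟_)
open import Data.Product using (_,_; proj₁; proj₂)
open import Data.Sum using (inj₁; inj₂)
open import Data.List using (List; []; _∷_; filter; length; cartesianProduct; allFin)
open import Data.List.Relation.Unary.Any using (here; there; any?)
open import Data.List.Membership.Propositional using (_∈_)
open import Data.List.Membership.Propositional.Properties using (∈-cartesianProduct⁺; ∈-allFin)
open import Induction.WellFounded using (Acc; acc)
open import Relation.Nullary using (¬_; Dec; yes; no; ¬?; contradiction)
open import Relation.Nullary.Decidable using (_×-dec_; _⊎-dec_)
open import Relation.Unary using (Pred; Decidable; _⊆_)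
open import Relation.Binary.PropositionalEquality using (_≢_; refl; sym; subst; subst₂)

module _ {a p q} {A : Set a} {P : Pred A p} {Q : Pred A q}
         (P? : Decidable P) (Q? : Decidable Q) (P⊆Q : P ⊆ Q) where

  length-filter-mono : ∀ xs → length (filter P? xs) ≤ length (filter Q? xs)
  length-filter-mono [] = z≤n
  length-filter-mono (y ∷ ys) with P? y | Q? y
  ... | yes _  | yes _ = s≤s (length-filter-mono ys)
  ... | yes Py | no ¬Qy = contradiction (P⊆Q Py) ¬Qy
  ... | no _   | yes _ = m≤n⇒m≤1+n (length-filter-mono ys)
  ... | no _   | no _  = length-filter-mono ys

  length-filter-mono-< : ∀ {x xs} → x ∈ xs → Q x → ¬ P x
                       → length (filter P? xs) < length (filter Q? xs)
  length-filter-mono-< {xs = y ∷ ys} (here refl) Qy ¬Py with P? y | Q? y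
  ... | yes Py | _      = contradiction Py ¬Py
  ... | no _   | yes _  = s≤s (length-filter-mono ys)
  ... | no _   | no ¬Qy = contradiction Qy ¬Qy
  length-filter-mono-< {xs = y ∷ ys} (there x∈ys) Qx ¬Px with P? y | Q? y
  ... | yes _  | yes _  = s≤s (length-filter-mono-< x∈ys Qx ¬Px)
  ... | yes Py | no ¬Qy = contradiction (P⊆Q Py) ¬Qy
  ... | no _   | yes _  = m≤n⇒m≤1+n (length-filter-mono-< x∈ys Qx ¬Px)
  ... | no _   | no _   = length-filter-mono-< x∈ys Qx ¬Px

module _ {n : ℕ} where

  Fresh : List (Move n) → Move n → Set
  Fresh used m = Unused used (tail m) (head m)

  sameEdge? : (m m′ : Move n) → Dec (SameEdge m m′)
  sameEdge? (u , v) (x , y) = ((u ≟ x) ×-dec (v ≟ y)) ⊎-dec ((u ≟ y) ×-dec (v ≟ x))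

  fresh? : (used : List (Move n)) → Decidable (Fresh used)
  fresh? used m = ¬? (any? (sameEdge? m) used)

  allMoves : List (Move n)
  allMoves = cartesianProduct (allFin n) (allFin n)

  ∈-allMoves : (m : Move n) → m ∈ allMoves
  ∈-allMoves (u , v) = ∈-cartesianProduct⁺ (∈-allFin u) (∈-allFin v)

  freshCount : List (Move n) → ℕ
  freshCount used = length (filter (fresh? used) allMoves)

  freshCount-< : ∀ {used m} → Fresh used m → freshCount (m ∷ used) < freshCount used
  freshCount-< {used} {m} fresh =
    length-filter-mono-< (fresh? (m ∷ used)) (fresh? used) (λ f u → f (there u))
      (∈-allMoves m) fresh (λ f → f (here (inj₁ (refl , refl))))

  sameEdge-map : ∀ (f : Fin n → Fin n) {u v x y}
               → SameEdge (u , v) (x , y) → SameEdge (f u , f v) (f x , f y)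
  sameEdge-map f (inj₁ (refl , refl)) = inj₁ (refl , refl)
  sameEdge-map f (inj₂ (refl , refl)) = inj₂ (refl , refl)

module MirrorStrategy {n} (G : Graph n) (used₀ : List (Move n)) (φ : Fin n → Fin n)
  (φ-aut : IsAutomorphism (AdjS G used₀) φ) (φ-inv : Involutive φ)
  (φ-noFixedEdges : NoFixedEdges (AdjS G used₀) φ) where

  open Play G

  record MirrorClosed (used : List (Move n)) : Set where
    field
      extends  : ∀ {u v} → Used used₀ u v → Used used u v
      φ-closed : ∀ {u v} → AdjS G used₀ u v → Used used u v → Used used (φ u) (φ v)
  open MirrorClosed

  mirrorClosed-initial : MirrorClosed used₀
  mirrorClosed-initial = record
    { extends  = λ u → u
    ; φ-closed = λ e u → contradiction u (proj₂ e)
    }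

  φ-preserves : ∀ {u v} → AdjS G used₀ u v → AdjS G used₀ (φ u) (φ v)
  φ-preserves {u} {v} = proj₁ (proj₂ φ-aut u v)

  φ-reflects-used : ∀ {used u v} → MirrorClosed used → AdjS G used₀ u v
                  → Used used (φ u) (φ v) → Used used u v
  φ-reflects-used {used} {u} {v} mc e u′ =
    subst₂ (Used used) (φ-inv u) (φ-inv v) (φ-closed mc (φ-preserves e) u′)

  sameEdge-φ⁻¹ : ∀ {u v x y} → SameEdge (u , v) (φ x , φ y) → SameEdge (φ u , φ v) (x , y)
  sameEdge-φ⁻¹ {x = x} {y} s =
    subst₂ (λ x′ y′ → SameEdge _ (x′ , y′)) (φ-inv x) (φ-inv y) (sameEdge-map φ s)

  edgeOfGS : ∀ {used a a′} → MirrorClosed used → Graph.Adj G a a′ → Unused used a a′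
           → AdjS G used₀ a a′
  edgeOfGS mc adj fresh = adj , λ u → fresh (extends mc u)

  mirror-fresh : ∀ {used a a′} → MirrorClosed used → AdjS G used₀ a a′ → Unused used a a′
               → Unused ((a , a′) ∷ used) (φ a) (φ a′)
  mirror-fresh {a = a} {a′} mc e fresh (here (inj₁ (φa≡a , φa′≡a′))) =
    φ-noFixedEdges a a′ e (inj₂ (φa≡a , φa′≡a′))
  mirror-fresh {a = a} {a′} mc e fresh (here (inj₂ (φa≡a′ , φa′≡a))) =
    φ-noFixedEdges a a′ e (inj₁ (φa≡a′ , φa′≡a))
  mirror-fresh mc e fresh (there u) = fresh (φ-reflects-used mc e u)

  mirrorClosed-step : ∀ {used a a′} → MirrorClosed used → AdjS G used₀ a a′
                    → MirrorClosed ((φ a , φ a′) ∷ (a , a′) ∷ used)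
  mirrorClosed-step mc e = record
    { extends  = λ u → there (there (extends mc u))
    ; φ-closed = closed
    }
    where
    closed : ∀ {u v} → AdjS G used₀ u v → Used _ u v → Used _ (φ u) (φ v)
    closed _  (here s)         = there (here (sameEdge-φ⁻¹ s))
    closed _  (there (here s)) = here (sameEdge-map φ s)
    closed e′ (there (there u)) = there (there (φ-closed mc e′ u))

  mover-loses : ∀ {used} a → MirrorClosed used → Acc _<_ (freshCount used)
              → Loses used a (φ a)
  mover-loses a mc (acc smaller) = loses λ a′ adj fresh →
    let e      = edgeOfGS mc adj fresh
        fresh′ = mirror-fresh mc e fresh
    in wins (φ a′) (proj₁ (φ-preserves e)) fresh′
         (mover-loses a′ (mirrorClosed-step mc e)
           (smaller (<-trans (freshCount-< fresh′) (freshCount-< fresh))))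

  mover-loses-initial : ∀ a → Loses used₀ a (φ a)
  mover-loses-initial a = mover-loses a mirrorClosed-initial (<-wellFounded _)

toMove-even : ∀ k → toMove (2 * k) ≡ P1
toMove-even zero = refl
toMove-even (suc k) rewrite +-suc k (k + 0) = toMove-even k

toMove-odd : ∀ k → toMove (suc (2 * k)) ≡ P2
toMove-odd zero = refl
toMove-odd (suc k) rewrite +-suc k (k + 0) = toMove-odd k

forPlayer-≢ : ∀ {p q} {W L : Set} → p ≢ q → L → forPlayer p q W L
forPlayer-≢ {P1} {P1} p≢q _ = contradiction refl p≢q
forPlayer-≢ {P1} {P2} _   l = l
forPlayer-≢ {P2} {P1} _   l = l
forPlayer-≢ {P2} {P2} p≢q _ = contradiction refl p≢q

proposition3p3 : ∀ {n} (G : Graph n) (r : ℕ) (h : 2 ≤ r) (S : PartialGame G r)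
    → (φ : Fin n → Fin n)
    → IsAutomorphism (AdjS G (usedOf S)) φ
    → Involutive φ
    → NoFixedEdges (AdjS G (usedOf S)) φ
    → φ (head (PartialGame.move S (secondLastIdx h))) ≡ head (PartialGame.move S (lastIdx h))
    → (Odd r → HasWinningStrategy G h S P1) × (Even r → HasWinningStrategy G h S P2)
proposition3p3 G r h S φ aut inv noFixed φv₁≡v₂ =
    (λ { (k , refl) → forPlayer-≢ (subst (_≢ P1) (sym (toMove-odd k)) λ ()) moverLoses })
  , (λ { (k , refl) → forPlayer-≢ (subst (_≢ P2) (sym (toMove-even k)) λ ()) moverLoses })
  where
  moverLoses = subst (Play.Loses G (usedOf S) _) φv₁≡v₂
    (MirrorStrategy.mover-loses-initial G (usedOf S) φ aut inv noFixed _)
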